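{- Let $q$ be a prime power and let $a\geq1$ be an integer. Then \[ \psi^{ - }_{1,a}(q)\geq q^{\binom{a+1}{2}}\left(1-\frac{1}{q}-\frac{1}{q^2}+\frac{1}{q^{a+1}}\right) \] and \[ \psi^{ - }_{1,2a}(q)\,\frac{q^{2a+2}-1}{q^2-1}\geq q^{\binom{2a+2}{2}-1}\left(1-\frac{1}{q}-\frac{1}{q^3}+\frac{q^2-q+1}{q^{2a+3}}\right). \]
   Context: For integers $b\ge a\ge0$, $\psi^{ - }_{a,b}(q)=\prod_{k=a}^{b}(q^k-1)$. -}

module Defs where

open import Data.Nat as ℕ using (ℕ; zero; suc; _∸_)
open import Data.Nat.Primality using (Prime)
open import Data.Product using (Σ; _×_)
open import Data.Integer using (+_)
open import Data.Rational using (ℚ; 0ℚ; 1ℚ; _/_; _*_; _-_)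
open import Relation.Binary.PropositionalEquality using (_≡_)

IsPrimePower : ℕ → Set
IsPrimePower q = Σ ℕ λ p → Σ ℕ λ k → Prime p × (1 ℕ.≤ k) × (q ≡ p ℕ.^ k)

⟦_⟧ : ℕ → ℚ
⟦ n ⟧ = + n / 1

-- reciprocal 1/n of a natural number as a rational (convention: 1/0 := 0,
-- never used since all denominators below are ≥ 1 when q ≥ 2)
inv : ℕ → ℚ
inv zero    = 0ℚ
inv (suc n) = + 1 / suc n

prodFrom : (ℕ → ℚ) → ℕ → ℕ → ℚ
prodFrom f a zero    = 1ℚ
prodFrom f a (suc n) = f a * prodFrom f (suc a) n

-- ψ⁻_{a,b}(q) = ∏_{k=a}^{b} (q^k - 1)   (empty product 1 if b < a)
ψ⁻ : ℕ → ℕ → ℕ → ℚ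
ψ⁻ a b q = prodFrom (λ k → ⟦ q ℕ.^ k ⟧ - 1ℚ) a (suc b ∸ a)

{-# OPTIONS --safe #-}
module Submission where

open import Defs
open import Data.Nat as ℕ using (ℕ; _∸_)
open import Data.Nat.Combinatorics using (_C_)
open import Data.Product using (_×_)
open import Data.Rational using (ℚ; 1ℚ; _*_; _+_; _-_; _≤_)

import Data.Rational.Properties as ℚ
open import Algebra.Bundles using (CommutativeRing)
open import Algebra.Properties.CommutativeSemigroup
  (CommutativeRing.*-commutativeSemigroup ℚ.+-*-commutativeRing) using (interchange)
open import Algebra.Properties.Semiring.Exp.TCOptimised
  (CommutativeRing.semiring ℚ.+-*-commutativeRing) using (^-homo-*)
open import Data.Integer as ℤ using (+_)
import Data.Integer.Properties as ℤ
open import Data.List.Base using (_∷_; [])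
open import Data.Nat using (zero; suc; z≤n; s≤s)
open import Data.Nat.Combinatorics using (nC1≡n; nCk+nC[k+1]≡[n+1]C[k+1])
open import Data.Nat.Primality using (prime⇒nonZero; prime⇒nonTrivial)
import Data.Nat.Properties as ℕ
import Data.Nat.Tactic.RingSolver as ℕ-Solver
open import Data.Product using (_,_)
open import Data.Rational using (0ℚ; -_; fromℚᵘ; toℚᵘ; nonNegative)
open import Data.Rational.Unnormalised as ᵘ using (ℚᵘ; mkℚᵘ)
import Data.Rational.Unnormalised.Properties as ᵘ
open import Level using (0ℓ)
open import Relation.Binary.PropositionalEquality
open import Relation.Nullary.Decidable using (dec⇒maybe)
open import Tactic.RingSolver using (solve-∀; solve)
import Tactic.RingSolver.Core.AlmostCommutativeRing as ACR

-- With t = 1/q we have q^k - 1 = q^k (1 - t^k), so ψ⁻ 1 a q = q^((a+1) choose 2) φ t a, where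
-- φ t a = ∏_{k=1}^{a} (1 - t^k) is the truncated Euler product; writing also q² - 1 = q² (1 - t²),
-- the two inequalities become, for 0 ≤ t ≤ 1/2 and a ≥ 1,
--   1 - t - t² + t^(a+1) ≤ φ t a,
--   (1 - t²) (1 - t - t³ + (1 - t + t²) t^(2a+1)) ≤ φ t (2a) (1 - t^(2a+2)).
-- Both are equalities at a = 1.  Going from a to a + 1 multiplies the right-hand sides by 1 - y,
-- resp. (1 - y) (1 - t³ y), where y = t^(a+1), resp. y = t^(2a+1), and the left-hand sides
-- become what one gets by replacing y with t y, resp. t² y.  The induction step is therefore a
-- polynomial inequality in t and y, whose two sides differ by y (t² - y), resp. by
-- y ((1 + t³) (t³ - (1 - t + t²) y) + (1 - t - t³ + (1 - t + t²) y) y t³); these are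
-- nonnegative since y ≤ t², resp. y ≤ t³ and 1 - t - t³ ≥ 0.

ℚ-ring : ACR.AlmostCommutativeRing 0ℓ 0ℓ
ℚ-ring = ACR.fromCommutativeRing ℚ.+-*-commutativeRing (λ p → dec⇒maybe (0ℚ ℚ.≟ p))

-- The solver recognises exactly this exponentiation (with literal exponents).
open ACR.AlmostCommutativeRing ℚ-ring using (_^_)

private variable
  p q r : ℚ
  m n : ℕ
  f g : ℕ → ℚ

+-nonNeg : 0ℚ ≤ p → 0ℚ ≤ q → 0ℚ ≤ p + q
+-nonNeg = ℚ.+-mono-≤

*-monoˡ-≤ : 0ℚ ≤ r → p ≤ q → r * p ≤ r * q
*-monoˡ-≤ {r} 0≤r = ℚ.*-monoˡ-≤-nonNeg r {{nonNegative 0≤r}}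

*-monoʳ-≤ : 0ℚ ≤ r → p ≤ q → p * r ≤ q * r
*-monoʳ-≤ {r} 0≤r = ℚ.*-monoʳ-≤-nonNeg r {{nonNegative 0≤r}}

*-nonNeg : 0ℚ ≤ p → 0ℚ ≤ q → 0ℚ ≤ p * q
*-nonNeg {p} {q} 0≤p 0≤q = subst (_≤ p * q) (ℚ.*-zeroʳ p) (*-monoˡ-≤ 0≤p 0≤q)

p≤q⇒0≤q-p : p ≤ q → 0ℚ ≤ q - p
p≤q⇒0≤q-p {p} {q} p≤q = subst (_≤ q - p) (ℚ.+-inverseʳ p) (ℚ.+-monoˡ-≤ (- p) p≤q)

≤-of-nonNeg-gap : q ≡ p + r → 0ℚ ≤ r → p ≤ q
≤-of-nonNeg-gap {q} {p} q≡p+r 0≤r =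
  subst₂ _≤_ (ℚ.+-identityʳ p) (sym q≡p+r) (ℚ.+-monoʳ-≤ p 0≤r)

0≤1 : 0ℚ ≤ 1ℚ
0≤1 = ℚ.nonNegative⁻¹ 1ℚ

^-suc : ∀ p n → p ^ suc n ≡ p * p ^ n
^-suc p = ^-homo-* p 1

^-nonNeg : ∀ n → 0ℚ ≤ p → 0ℚ ≤ p ^ n
^-nonNeg zero        _   = 0≤1
^-nonNeg {p} (suc n) 0≤p = subst (0ℚ ≤_) (sym (^-suc p n)) (*-nonNeg 0≤p (^-nonNeg n 0≤p))

^≤1 : ∀ n → 0ℚ ≤ p → p ≤ 1ℚ → p ^ n ≤ 1ℚ
^≤1 zero        _   _   = ℚ.≤-refl
^≤1 {p} (suc n) 0≤p p≤1 = begin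
  p ^ suc n  ≡⟨ ^-suc p n ⟩
  p * p ^ n  ≤⟨ *-monoˡ-≤ 0≤p (^≤1 n 0≤p p≤1) ⟩
  p * 1ℚ     ≡⟨ ℚ.*-identityʳ p ⟩
  p          ≤⟨ p≤1 ⟩
  1ℚ         ∎
  where open ℚ.≤-Reasoning

^-antitone : 0ℚ ≤ p → p ≤ 1ℚ → m ℕ.≤ n → p ^ n ≤ p ^ m
^-antitone {n = n} 0≤p p≤1 z≤n = ^≤1 n 0≤p p≤1
^-antitone {p} {suc m} {suc n} 0≤p p≤1 (s≤s m≤n) = begin
  p ^ suc n  ≡⟨ ^-suc p n ⟩
  p * p ^ n  ≤⟨ *-monoˡ-≤ 0≤p (^-antitone 0≤p p≤1 m≤n) ⟩
  p * p ^ m  ≡⟨ ^-suc p m ⟨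
  p ^ suc m  ∎
  where open ℚ.≤-Reasoning

^-inverse : ∀ n → p * q ≡ 1ℚ → p ^ n * q ^ n ≡ 1ℚ
^-inverse zero            _    = refl
^-inverse {p} {q} (suc n) pq≡1 = begin
  p ^ suc n * q ^ suc n      ≡⟨ cong₂ _*_ (^-suc p n) (^-suc q n) ⟩
  (p * p ^ n) * (q * q ^ n)  ≡⟨ interchange p (p ^ n) q (q ^ n) ⟩
  (p * q) * (p ^ n * q ^ n)  ≡⟨ cong₂ _*_ pq≡1 (^-inverse n pq≡1) ⟩
  1ℚ                         ∎
  where open ≡-Reasoning

*-inverse-unique : p * q ≡ 1ℚ → p * r ≡ 1ℚ → q ≡ r
*-inverse-unique {p} {q} {r} pq≡1 pr≡1 = begin
  q              ≡⟨ ℚ.*-identityʳ q ⟨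
  q * 1ℚ         ≡⟨ cong (q *_) pr≡1 ⟨
  q * (p * r)    ≡⟨ solve (p ∷ q ∷ r ∷ []) ℚ-ring ⟩
  (p * q) * r    ≡⟨ cong (_* r) pq≡1 ⟩
  1ℚ * r         ≡⟨ ℚ.*-identityˡ r ⟩
  r              ∎
  where open ≡-Reasoning

p*[1-q]≡p-1 : p * q ≡ 1ℚ → p * (1ℚ - q) ≡ p - 1ℚ
p*[1-q]≡p-1 {p} {q} pq≡1 = begin
  p * (1ℚ - q)  ≡⟨ solve (p ∷ q ∷ []) ℚ-ring ⟩
  p - p * q     ≡⟨ cong (λ w → p - w) pq≡1 ⟩
  p - 1ℚ        ∎
  where open ≡-Reasoning

[p²-p+1]q²≡1-q+q² : p * q ≡ 1ℚ → (p ^ 2 - p + 1ℚ) * q ^ 2 ≡ 1ℚ - q + q ^ 2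
[p²-p+1]q²≡1-q+q² {p} {q} pq≡1 = begin
  (p ^ 2 - p + 1ℚ) * q ^ 2               ≡⟨ solve (p ∷ q ∷ []) ℚ-ring ⟩
  (p * q) ^ 2 - (p * q) * q + q ^ 2      ≡⟨ cong (λ w → w ^ 2 - w * q + q ^ 2) pq≡1 ⟩
  1ℚ ^ 2 - 1ℚ * q + q ^ 2                ≡⟨ solve (q ∷ []) ℚ-ring ⟩
  1ℚ - q + q ^ 2                         ∎
  where open ≡-Reasoning

prodFrom-cong : (∀ k → f k ≡ g k) → ∀ m n → prodFrom f m n ≡ prodFrom g m n
prodFrom-cong f≗g m zero    = refl
prodFrom-cong f≗g m (suc n) = cong₂ _*_ (f≗g m) (prodFrom-cong f≗g (suc m) n)

prodFrom-suc : ∀ f m n → prodFrom f m (suc n) ≡ prodFrom f m n * f (m ℕ.+ n)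
prodFrom-suc f m zero = begin
  f m * 1ℚ            ≡⟨ ℚ.*-identityʳ (f m) ⟩
  f m                 ≡⟨ cong f (ℕ.+-identityʳ m) ⟨
  f (m ℕ.+ 0)         ≡⟨ ℚ.*-identityˡ _ ⟨
  1ℚ * f (m ℕ.+ 0)    ∎
  where open ≡-Reasoning
prodFrom-suc f m (suc n) = begin
  f m * prodFrom f (suc m) (suc n)                  ≡⟨ cong (f m *_) (prodFrom-suc f (suc m) n) ⟩
  f m * (prodFrom f (suc m) n * f (suc m ℕ.+ n))    ≡⟨ ℚ.*-assoc (f m) _ _ ⟨
  f m * prodFrom f (suc m) n * f (suc m ℕ.+ n)      ≡⟨ cong (λ k → f m * prodFrom f (suc m) n * f k) (ℕ.+-suc m n) ⟨
  f m * prodFrom f (suc m) n * f (m ℕ.+ suc n)      ∎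
  where open ≡-Reasoning

prodFrom-* : ∀ f g m n → prodFrom (λ k → f k * g k) m n ≡ prodFrom f m n * prodFrom g m n
prodFrom-* f g m zero    = refl
prodFrom-* f g m (suc n) = begin
  (f m * g m) * prodFrom (λ k → f k * g k) (suc m) n
    ≡⟨ cong ((f m * g m) *_) (prodFrom-* f g (suc m) n) ⟩
  (f m * g m) * (prodFrom f (suc m) n * prodFrom g (suc m) n)
    ≡⟨ interchange (f m) (g m) _ _ ⟩
  (f m * prodFrom f (suc m) n) * (g m * prodFrom g (suc m) n)
    ∎
  where open ≡-Reasoning

[1+n]C2≡n+nC2 : ∀ n → suc n C 2 ≡ n ℕ.+ n C 2
[1+n]C2≡n+nC2 n = trans (sym (nCk+nC[k+1]≡[n+1]C[k+1] n 1)) (cong (ℕ._+ n C 2) (nC1≡n n))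

[2a+1]C2+[2a+2]≡[2a+2]C2∸1+2 : ∀ a → suc (2 ℕ.* a) C 2 ℕ.+ (2 ℕ.* a ℕ.+ 2) ≡ (2 ℕ.* a ℕ.+ 2) C 2 ∸ 1 ℕ.+ 2
[2a+1]C2+[2a+2]≡[2a+2]C2∸1+2 a = begin
  c ℕ.+ (2 ℕ.* a ℕ.+ 2)                 ≡⟨ shuffle (2 ℕ.* a) c ⟩
  2 ℕ.* a ℕ.+ c ℕ.+ 2                   ≡⟨ cong (λ n → n ∸ 1 ℕ.+ 2) ([1+n]C2≡n+nC2 (suc (2 ℕ.* a))) ⟨
  suc (suc (2 ℕ.* a)) C 2 ∸ 1 ℕ.+ 2     ≡⟨ cong (λ n → n C 2 ∸ 1 ℕ.+ 2) (ℕ.+-comm 2 (2 ℕ.* a)) ⟩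
  (2 ℕ.* a ℕ.+ 2) C 2 ∸ 1 ℕ.+ 2         ∎
  where
  open ≡-Reasoning
  c : ℕ
  c = suc (2 ℕ.* a) C 2
  shuffle : ∀ m c → c ℕ.+ (m ℕ.+ 2) ≡ m ℕ.+ c ℕ.+ 2
  shuffle = ℕ-Solver.solve-∀

prodFrom-^ : ∀ p n → prodFrom (p ^_) 1 n ≡ p ^ (suc n C 2)
prodFrom-^ p zero = refl
prodFrom-^ p (suc n) = begin
  prodFrom (p ^_) 1 (suc n)            ≡⟨ prodFrom-suc (p ^_) 1 n ⟩
  prodFrom (p ^_) 1 n * p ^ suc n      ≡⟨ cong (_* p ^ suc n) (prodFrom-^ p n) ⟩
  p ^ (suc n C 2) * p ^ suc n          ≡⟨ ^-homo-* p (suc n C 2) (suc n) ⟨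
  p ^ (suc n C 2 ℕ.+ suc n)            ≡⟨ cong (p ^_) (trans (ℕ.+-comm (suc n C 2) (suc n)) (sym ([1+n]C2≡n+nC2 (suc n)))) ⟩
  p ^ (suc (suc n) C 2)                ∎
  where open ≡-Reasoning

φ : ℚ → ℕ → ℚ
φ t = prodFrom (λ k → 1ℚ - t ^ k) 1

φ-suc : ∀ t n → φ t (suc n) ≡ φ t n * (1ℚ - t ^ suc n)
φ-suc t = prodFrom-suc (λ k → 1ℚ - t ^ k) 1

φ-even-suc : ∀ t a →
  φ t (2 ℕ.* suc a) * (1ℚ - t ^ (2 ℕ.* suc a ℕ.+ 2))
    ≡ φ t (2 ℕ.* a) * (1ℚ - t ^ (2 ℕ.* a ℕ.+ 2))
      * ((1ℚ - t ^ (2 ℕ.* a ℕ.+ 1)) * (1ℚ - t ^ 3 * t ^ (2 ℕ.* a ℕ.+ 1)))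
φ-even-suc t a = begin
  φ t (2 ℕ.* suc a) * (1ℚ - t ^ (2 ℕ.* suc a ℕ.+ 2))
    ≡⟨ cong₂ (λ i j → φ t i * (1ℚ - t ^ j)) (ℕ.*-suc 2 a) (2[1+a]+2≡3+[2a+1] a) ⟩
  φ t (suc (suc b)) * (1ℚ - t ^ (3 ℕ.+ (b ℕ.+ 1)))
    ≡⟨ cong₂ (λ u v → u * (1ℚ - v))
             (trans (φ-suc t (suc b)) (cong (_* (1ℚ - t ^ suc (suc b))) (φ-suc t b)))
             (^-homo-* t 3 (b ℕ.+ 1)) ⟩
  φ t b * (1ℚ - t ^ suc b) * (1ℚ - t ^ suc (suc b)) * (1ℚ - t ^ 3 * t ^ (b ℕ.+ 1))
    ≡⟨ cong₂ (λ i j → φ t b * (1ℚ - t ^ i) * (1ℚ - t ^ j) * (1ℚ - t ^ 3 * t ^ (b ℕ.+ 1))) (1+2a≡2a+1 a) (2+2a≡2a+2 a) ⟩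
  φ t b * (1ℚ - t ^ (b ℕ.+ 1)) * (1ℚ - t ^ (b ℕ.+ 2)) * (1ℚ - t ^ 3 * t ^ (b ℕ.+ 1))
    ≡⟨ reorder (φ t b) (t ^ (b ℕ.+ 1)) (t ^ (b ℕ.+ 2)) (t ^ 3 * t ^ (b ℕ.+ 1)) ⟩
  φ t b * (1ℚ - t ^ (b ℕ.+ 2)) * ((1ℚ - t ^ (b ℕ.+ 1)) * (1ℚ - t ^ 3 * t ^ (b ℕ.+ 1)))
    ∎
  where
  open ≡-Reasoning
  b : ℕ
  b = 2 ℕ.* a
  2[1+a]+2≡3+[2a+1] : ∀ a → 2 ℕ.* suc a ℕ.+ 2 ≡ 3 ℕ.+ (2 ℕ.* a ℕ.+ 1)
  2[1+a]+2≡3+[2a+1] = ℕ-Solver.solve-∀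
  1+2a≡2a+1 : ∀ a → suc (2 ℕ.* a) ≡ 2 ℕ.* a ℕ.+ 1
  1+2a≡2a+1 = ℕ-Solver.solve-∀
  2+2a≡2a+2 : ∀ a → suc (suc (2 ℕ.* a)) ≡ 2 ℕ.* a ℕ.+ 2
  2+2a≡2a+2 = ℕ-Solver.solve-∀
  reorder : ∀ Φ q r w → Φ * (1ℚ - q) * (1ℚ - r) * (1ℚ - w) ≡ Φ * (1ℚ - r) * ((1ℚ - q) * (1ℚ - w))
  reorder = solve-∀ ℚ-ring

module EulerBounds {t : ℚ} (0≤t : 0ℚ ≤ t) (2t≤1 : t + t ≤ 1ℚ) where

  t≤1 : t ≤ 1ℚ
  t≤1 = ℚ.≤-trans (≤-of-nonNeg-gap refl 0≤t) 2t≤1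

  0≤1-t^ : ∀ n → 0ℚ ≤ 1ℚ - t ^ n
  0≤1-t^ n = p≤q⇒0≤q-p (^≤1 n 0≤t t≤1)

  φ-lower-bound-step : ∀ {y} → 0ℚ ≤ y → y ≤ t ^ 2 →
    1ℚ - t - t ^ 2 + t * y ≤ (1ℚ - t - t ^ 2 + y) * (1ℚ - y)
  φ-lower-bound-step {y} 0≤y y≤t² = ≤-of-nonNeg-gap (gap t y) (*-nonNeg 0≤y (p≤q⇒0≤q-p y≤t²))
    where
    gap : ∀ t y → (1ℚ - t - t ^ 2 + y) * (1ℚ - y) ≡ 1ℚ - t - t ^ 2 + t * y + y * (t ^ 2 - y)
    gap = solve-∀ ℚ-ring

  φ-lower-bound : ∀ a → 1 ℕ.≤ a → 1ℚ - t - t ^ 2 + t ^ (a ℕ.+ 1) ≤ φ t a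
  φ-lower-bound 1 _ = ℚ.≤-reflexive (base t)
    where
    base : ∀ t → 1ℚ - t - t ^ 2 + t ^ 2 ≡ (1ℚ - t ^ 1) * 1ℚ
    base = solve-∀ ℚ-ring
  φ-lower-bound (suc a@(suc b)) _ = begin
    1ℚ - t - t ^ 2 + t ^ (suc a ℕ.+ 1)  ≡⟨ cong (λ w → 1ℚ - t - t ^ 2 + w) (^-suc t (a ℕ.+ 1)) ⟩
    1ℚ - t - t ^ 2 + t * y              ≤⟨ φ-lower-bound-step 0≤y y≤t² ⟩
    (1ℚ - t - t ^ 2 + y) * (1ℚ - y)     ≤⟨ *-monoʳ-≤ (0≤1-t^ (a ℕ.+ 1)) (φ-lower-bound a (s≤s z≤n)) ⟩
    φ t a * (1ℚ - y)                    ≡⟨ cong (λ n → φ t a * (1ℚ - t ^ n)) (ℕ.+-comm a 1) ⟩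
    φ t a * (1ℚ - t ^ suc a)            ≡⟨ φ-suc t a ⟨
    φ t (suc a)                         ∎
    where
    open ℚ.≤-Reasoning
    y : ℚ
    y = t ^ (a ℕ.+ 1)
    0≤y : 0ℚ ≤ y
    0≤y = ^-nonNeg (a ℕ.+ 1) 0≤t
    y≤t² : y ≤ t ^ 2
    y≤t² = ^-antitone 0≤t t≤1 (s≤s (ℕ.m≤n+m 1 b))

  φ-even-lower-bound-step : ∀ {y} → 0ℚ ≤ y → y ≤ t ^ 3 →
    1ℚ - t - t ^ 3 + (1ℚ - t + t ^ 2) * (t ^ 2 * y)
      ≤ (1ℚ - t - t ^ 3 + (1ℚ - t + t ^ 2) * y) * ((1ℚ - y) * (1ℚ - t ^ 3 * y))
  φ-even-lower-bound-step {y} 0≤y y≤t³ = ≤-of-nonNeg-gap (gap t y)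
    (*-nonNeg 0≤y (+-nonNeg (*-nonNeg 0≤1+t³ 0≤t³-sy) (*-nonNeg (*-nonNeg 0≤B+sy 0≤y) (^-nonNeg 3 0≤t))))
    where
    s B : ℚ
    s = 1ℚ - t + t ^ 2
    B = 1ℚ - t - t ^ 3
    gap : ∀ t y → (1ℚ - t - t ^ 3 + (1ℚ - t + t ^ 2) * y) * ((1ℚ - y) * (1ℚ - t ^ 3 * y))
      ≡ 1ℚ - t - t ^ 3 + (1ℚ - t + t ^ 2) * (t ^ 2 * y)
        + y * ((1ℚ + t ^ 3) * (t ^ 3 - (1ℚ - t + t ^ 2) * y)
               + (1ℚ - t - t ^ 3 + (1ℚ - t + t ^ 2) * y) * y * t ^ 3)
    gap = solve-∀ ℚ-ring
    B-split : ∀ t → 1ℚ - (t + t) + t * (1ℚ - t ^ 2) ≡ 1ℚ - t - t ^ 3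
    B-split = solve-∀ ℚ-ring
    s-split : ∀ t → 1ℚ ≡ 1ℚ - t + t ^ 2 + t * (1ℚ - t)
    s-split = solve-∀ ℚ-ring
    0≤s : 0ℚ ≤ s
    0≤s = +-nonNeg (p≤q⇒0≤q-p t≤1) (^-nonNeg 2 0≤t)
    s≤1 : s ≤ 1ℚ
    s≤1 = ≤-of-nonNeg-gap (s-split t) (*-nonNeg 0≤t (p≤q⇒0≤q-p t≤1))
    -- the only place where t ≤ 1/2 rather than t ≤ 1 is needed
    0≤B : 0ℚ ≤ B
    0≤B = subst (0ℚ ≤_) (B-split t) (+-nonNeg (p≤q⇒0≤q-p 2t≤1) (*-nonNeg 0≤t (0≤1-t^ 2)))
    0≤1+t³ : 0ℚ ≤ 1ℚ + t ^ 3
    0≤1+t³ = +-nonNeg 0≤1 (^-nonNeg 3 0≤t)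
    0≤B+sy : 0ℚ ≤ B + s * y
    0≤B+sy = +-nonNeg 0≤B (*-nonNeg 0≤s 0≤y)
    0≤t³-sy : 0ℚ ≤ t ^ 3 - s * y
    0≤t³-sy = p≤q⇒0≤q-p (ℚ.≤-trans (subst (s * y ≤_) (ℚ.*-identityˡ y) (*-monoʳ-≤ 0≤y s≤1)) y≤t³)

  φ-even-lower-bound : ∀ a → 1 ℕ.≤ a →
    (1ℚ - t ^ 2) * (1ℚ - t - t ^ 3 + (1ℚ - t + t ^ 2) * t ^ (2 ℕ.* a ℕ.+ 1))
      ≤ φ t (2 ℕ.* a) * (1ℚ - t ^ (2 ℕ.* a ℕ.+ 2))
  φ-even-lower-bound 1 _ = ℚ.≤-reflexive (base t)
    where
    base : ∀ t → (1ℚ - t ^ 2) * (1ℚ - t - t ^ 3 + (1ℚ - t + t ^ 2) * t ^ 3)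
      ≡ (1ℚ - t ^ 1) * ((1ℚ - t ^ 2) * 1ℚ) * (1ℚ - t ^ 4)
    base = solve-∀ ℚ-ring
  φ-even-lower-bound (suc a@(suc b)) _ = begin
    (1ℚ - t ^ 2) * (B + s * t ^ (2 ℕ.* suc a ℕ.+ 1))
      ≡⟨ cong (λ w → (1ℚ - t ^ 2) * (B + s * w)) t^[2a+3]≡t²y ⟩
    (1ℚ - t ^ 2) * (B + s * (t ^ 2 * y))
      ≤⟨ *-monoˡ-≤ (0≤1-t^ 2) (φ-even-lower-bound-step 0≤y y≤t³) ⟩
    (1ℚ - t ^ 2) * ((B + s * y) * ((1ℚ - y) * (1ℚ - t ^ 3 * y)))
      ≡⟨ ℚ.*-assoc (1ℚ - t ^ 2) _ _ ⟨
    (1ℚ - t ^ 2) * (B + s * y) * ((1ℚ - y) * (1ℚ - t ^ 3 * y))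
      ≤⟨ *-monoʳ-≤ (*-nonNeg (0≤1-t^ (2 ℕ.* a ℕ.+ 1)) (p≤q⇒0≤q-p t³y≤1)) (φ-even-lower-bound a (s≤s z≤n)) ⟩
    φ t (2 ℕ.* a) * (1ℚ - t ^ (2 ℕ.* a ℕ.+ 2)) * ((1ℚ - y) * (1ℚ - t ^ 3 * y))
      ≡⟨ φ-even-suc t a ⟨
    φ t (2 ℕ.* suc a) * (1ℚ - t ^ (2 ℕ.* suc a ℕ.+ 2))
      ∎
    where
    open ℚ.≤-Reasoning
    s B y : ℚ
    s = 1ℚ - t + t ^ 2
    B = 1ℚ - t - t ^ 3
    y = t ^ (2 ℕ.* a ℕ.+ 1)
    0≤y : 0ℚ ≤ y
    0≤y = ^-nonNeg (2 ℕ.* a ℕ.+ 1) 0≤t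
    y≤t³ : y ≤ t ^ 3
    y≤t³ = ^-antitone 0≤t t≤1 (exponent≥3 b)
      where
      exponent≥3 : ∀ b → 3 ℕ.≤ 2 ℕ.* suc b ℕ.+ 1
      exponent≥3 b = subst (3 ℕ.≤_) (3+2b≡2[1+b]+1 b) (ℕ.m≤m+n 3 (2 ℕ.* b))
        where
        3+2b≡2[1+b]+1 : ∀ b → 3 ℕ.+ 2 ℕ.* b ≡ 2 ℕ.* suc b ℕ.+ 1
        3+2b≡2[1+b]+1 = ℕ-Solver.solve-∀
    t³y≤1 : t ^ 3 * y ≤ 1ℚ
    t³y≤1 = subst (_≤ 1ℚ) (^-homo-* t 3 (2 ℕ.* a ℕ.+ 1)) (^≤1 (3 ℕ.+ (2 ℕ.* a ℕ.+ 1)) 0≤t t≤1)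
    t^[2a+3]≡t²y : t ^ (2 ℕ.* suc a ℕ.+ 1) ≡ t ^ 2 * y
    t^[2a+3]≡t²y = trans (cong (t ^_) (2[1+a]+1≡2+[2a+1] a)) (^-homo-* t 2 (2 ℕ.* a ℕ.+ 1))
      where
      2[1+a]+1≡2+[2a+1] : ∀ a → 2 ℕ.* suc a ℕ.+ 1 ≡ 2 ℕ.+ (2 ℕ.* a ℕ.+ 1)
      2[1+a]+1≡2+[2a+1] = ℕ-Solver.solve-∀

fromℚᵘ-homo-+ : ∀ p q → fromℚᵘ (p ᵘ.+ q) ≡ fromℚᵘ p + fromℚᵘ q
fromℚᵘ-homo-+ p q = ℚ.toℚᵘ-injective (begin
  toℚᵘ (fromℚᵘ (p ᵘ.+ q))               ≈⟨ ℚ.toℚᵘ-fromℚᵘ (p ᵘ.+ q) ⟩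
  p ᵘ.+ q                               ≈⟨ ᵘ.+-cong (ℚ.toℚᵘ-fromℚᵘ p) (ℚ.toℚᵘ-fromℚᵘ q) ⟨
  toℚᵘ (fromℚᵘ p) ᵘ.+ toℚᵘ (fromℚᵘ q)   ≈⟨ ℚ.toℚᵘ-homo-+ (fromℚᵘ p) (fromℚᵘ q) ⟨
  toℚᵘ (fromℚᵘ p + fromℚᵘ q)            ∎)
  where open ᵘ.≃-Reasoning

fromℚᵘ-homo-* : ∀ p q → fromℚᵘ (p ᵘ.* q) ≡ fromℚᵘ p * fromℚᵘ q
fromℚᵘ-homo-* p q = ℚ.toℚᵘ-injective (begin
  toℚᵘ (fromℚᵘ (p ᵘ.* q))               ≈⟨ ℚ.toℚᵘ-fromℚᵘ (p ᵘ.* q) ⟩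
  p ᵘ.* q                               ≈⟨ ᵘ.*-cong (ℚ.toℚᵘ-fromℚᵘ p) (ℚ.toℚᵘ-fromℚᵘ q) ⟨
  toℚᵘ (fromℚᵘ p) ᵘ.* toℚᵘ (fromℚᵘ q)   ≈⟨ ℚ.toℚᵘ-homo-* (fromℚᵘ p) (fromℚᵘ q) ⟨
  toℚᵘ (fromℚᵘ p * fromℚᵘ q)            ∎)
  where open ᵘ.≃-Reasoning

-- ⟦ n ⟧ and inv (suc n) are definitionally fromℚᵘ of the unnormalised fractions n/1 and
-- 1/(suc n), on which the identities below reduce to integer identities.
n/1 : ℕ → ℚᵘ
n/1 n = mkℚᵘ (+ n) 0

⟦⟧-homo-+ : ∀ m n → ⟦ m ℕ.+ n ⟧ ≡ ⟦ m ⟧ + ⟦ n ⟧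
⟦⟧-homo-+ m n =
  trans (ℚ.fromℚᵘ-cong {n/1 (m ℕ.+ n)} {n/1 m ᵘ.+ n/1 n} (ᵘ.*≡* (cong (ℤ._* + 1) m+n≡m*1+n*1)))
        (fromℚᵘ-homo-+ (n/1 m) (n/1 n))
  where
  m+n≡m*1+n*1 : + (m ℕ.+ n) ≡ + m ℤ.* + 1 ℤ.+ + n ℤ.* + 1
  m+n≡m*1+n*1 = trans (ℤ.pos-+ m n) (sym (cong₂ ℤ._+_ (ℤ.*-identityʳ (+ m)) (ℤ.*-identityʳ (+ n))))

⟦⟧-homo-* : ∀ m n → ⟦ m ℕ.* n ⟧ ≡ ⟦ m ⟧ * ⟦ n ⟧
⟦⟧-homo-* m n =
  trans (ℚ.fromℚᵘ-cong {n/1 (m ℕ.* n)} {n/1 m ᵘ.* n/1 n} (ᵘ.*≡* (cong (ℤ._* + 1) (ℤ.pos-* m n))))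
        (fromℚᵘ-homo-* (n/1 m) (n/1 n))

⟦⟧-homo-∸ : ∀ {m n} → n ℕ.≤ m → ⟦ m ∸ n ⟧ ≡ ⟦ m ⟧ - ⟦ n ⟧
⟦⟧-homo-∸ {m} {n} n≤m = begin
  ⟦ m ∸ n ⟧                  ≡⟨ p≡p+q-q ⟦ m ∸ n ⟧ ⟦ n ⟧ ⟩
  ⟦ m ∸ n ⟧ + ⟦ n ⟧ - ⟦ n ⟧  ≡⟨ cong (_- ⟦ n ⟧) (⟦⟧-homo-+ (m ∸ n) n) ⟨
  ⟦ m ∸ n ℕ.+ n ⟧ - ⟦ n ⟧    ≡⟨ cong (λ k → ⟦ k ⟧ - ⟦ n ⟧) (ℕ.m∸n+n≡m n≤m) ⟩
  ⟦ m ⟧ - ⟦ n ⟧              ∎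
  where
  open ≡-Reasoning
  p≡p+q-q : ∀ p q → p ≡ p + q - q
  p≡p+q-q = solve-∀ ℚ-ring

⟦⟧-nonNeg : ∀ n → 0ℚ ≤ ⟦ n ⟧
⟦⟧-nonNeg n = ℚ.nonNegative⁻¹ _ {{ℚ.normalize-nonNeg n 1}}

⟦⟧-mono-≤ : m ℕ.≤ n → ⟦ m ⟧ ≤ ⟦ n ⟧
⟦⟧-mono-≤ {m} {n} m≤n =
  ≤-of-nonNeg-gap (trans (cong ⟦_⟧ (sym (ℕ.m+[n∸m]≡n m≤n))) (⟦⟧-homo-+ m (n ∸ m))) (⟦⟧-nonNeg (n ∸ m))

inv-nonNeg : ∀ n → 0ℚ ≤ inv n
inv-nonNeg zero    = ℚ.≤-refl
inv-nonNeg (suc n) = ℚ.nonNegative⁻¹ _ {{ℚ.normalize-nonNeg 1 (suc n)}}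

⟦⟧*inv≡1 : ∀ n .{{_ : ℕ.NonZero n}} → ⟦ n ⟧ * inv n ≡ 1ℚ
⟦⟧*inv≡1 (suc n) = trans (sym (fromℚᵘ-homo-* (n/1 (suc n)) (mkℚᵘ (+ 1) n)))
                         (ℚ.fromℚᵘ-cong {n/1 (suc n) ᵘ.* mkℚᵘ (+ 1) n} {n/1 1} (ᵘ.*≡* both-sides-1+n))
  where
  both-sides-1+n : (+ suc n ℤ.* + 1) ℤ.* + 1 ≡ + 1 ℤ.* + (1 ℕ.* suc n)
  both-sides-1+n = trans (ℤ.*-identityʳ _) (trans (ℤ.*-identityʳ (+ suc n))
                 (sym (trans (ℤ.*-identityˡ _) (cong +_ (ℕ.*-identityˡ (suc n))))))

module _ (q : ℕ) (2≤q : 2 ℕ.≤ q) where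

  private
    instance
      q≢0 : ℕ.NonZero q
      q≢0 = ℕ.>-nonZero (ℕ.≤-trans (s≤s z≤n) 2≤q)

    Q t : ℚ
    Q = ⟦ q ⟧
    t = inv q

    Qt≡1 : Q * t ≡ 1ℚ
    Qt≡1 = ⟦⟧*inv≡1 q

    0≤Q : 0ℚ ≤ Q
    0≤Q = ⟦⟧-nonNeg q

    0≤t : 0ℚ ≤ t
    0≤t = inv-nonNeg q

    2t≤1 : t + t ≤ 1ℚ
    2t≤1 = begin
      t + t     ≡⟨ two-t t ⟩
      ⟦ 2 ⟧ * t ≤⟨ *-monoʳ-≤ 0≤t (⟦⟧-mono-≤ 2≤q) ⟩
      Q * t     ≡⟨ Qt≡1 ⟩
      1ℚ        ∎
      where
      open ℚ.≤-Reasoning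
      two-t : ∀ t → t + t ≡ ⟦ 2 ⟧ * t
      two-t = solve-∀ ℚ-ring

    ⟦q^⟧ : ∀ n → ⟦ q ℕ.^ n ⟧ ≡ Q ^ n
    ⟦q^⟧ zero    = refl
    ⟦q^⟧ (suc n) = trans (⟦⟧-homo-* q (q ℕ.^ n)) (trans (cong (Q *_) (⟦q^⟧ n)) (sym (^-suc Q n)))

    inv-q^ : ∀ n → inv (q ℕ.^ n) ≡ t ^ n
    inv-q^ n = *-inverse-unique {Q ^ n}
      (trans (cong (_* inv (q ℕ.^ n)) (sym (⟦q^⟧ n))) (⟦⟧*inv≡1 (q ℕ.^ n) {{ℕ.m^n≢0 q n}}))
      (^-inverse {Q} {t} n Qt≡1)

    ⟦q^⟧-1 : ∀ n → ⟦ q ℕ.^ n ⟧ - 1ℚ ≡ Q ^ n * (1ℚ - t ^ n)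
    ⟦q^⟧-1 n = trans (cong (_- 1ℚ) (⟦q^⟧ n)) (sym (p*[1-q]≡p-1 {Q ^ n} {t ^ n} (^-inverse n Qt≡1)))

    ψ⁻≡Q^C*φ : ∀ a → ψ⁻ 1 a q ≡ Q ^ (suc a C 2) * φ t a
    ψ⁻≡Q^C*φ a = begin
      ψ⁻ 1 a q                                    ≡⟨ prodFrom-cong ⟦q^⟧-1 1 a ⟩
      prodFrom (λ k → Q ^ k * (1ℚ - t ^ k)) 1 a   ≡⟨ prodFrom-* (Q ^_) (λ k → 1ℚ - t ^ k) 1 a ⟩
      prodFrom (Q ^_) 1 a * φ t a                 ≡⟨ cong (_* φ t a) (prodFrom-^ Q a) ⟩
      Q ^ (suc a C 2) * φ t a                     ∎
      where open ≡-Reasoning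

    q≤q² : q ℕ.≤ q ℕ.^ 2
    q≤q² = ℕ.m≤m*n q (q ℕ.^ 1) {{ℕ.m^n≢0 q 1}}

    κ : ℚ
    κ = inv (q ℕ.^ 2 ∸ 1)

    Q²[1-t²]κ≡1 : Q ^ 2 * (1ℚ - t ^ 2) * κ ≡ 1ℚ
    Q²[1-t²]κ≡1 = begin
      Q ^ 2 * (1ℚ - t ^ 2) * κ  ≡⟨ cong (_* κ) (p*[1-q]≡p-1 {Q ^ 2} {t ^ 2} (^-inverse {Q} {t} 2 Qt≡1)) ⟩
      (Q ^ 2 - 1ℚ) * κ          ≡⟨ cong (λ w → (w - 1ℚ) * κ) (⟦q^⟧ 2) ⟨
      (⟦ q ℕ.^ 2 ⟧ - ⟦ 1 ⟧) * κ  ≡⟨ cong (_* κ) (⟦⟧-homo-∸ 1≤q²) ⟨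
      ⟦ q ℕ.^ 2 ∸ 1 ⟧ * κ        ≡⟨ ⟦⟧*inv≡1 (q ℕ.^ 2 ∸ 1) {{ℕ.>-nonZero (ℕ.∸-monoˡ-≤ 1 2≤q²)}} ⟩
      1ℚ                        ∎
      where
      open ≡-Reasoning
      2≤q² : 2 ℕ.≤ q ℕ.^ 2
      2≤q² = ℕ.≤-trans 2≤q q≤q²
      1≤q² : 1 ℕ.≤ q ℕ.^ 2
      1≤q² = ℕ.≤-trans (s≤s z≤n) 2≤q²

    ⟦q²-q+1⟧ : ⟦ q ℕ.^ 2 ∸ q ℕ.+ 1 ⟧ ≡ Q ^ 2 - Q + 1ℚ
    ⟦q²-q+1⟧ = trans (⟦⟧-homo-+ (q ℕ.^ 2 ∸ q) 1)
                     (cong (_+ 1ℚ) (trans (⟦⟧-homo-∸ q≤q²) (cong (_- Q) (⟦q^⟧ 2))))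

    ⟦q²-q+1⟧*inv[q^[2a+3]] : ∀ a →
      ⟦ q ℕ.^ 2 ∸ q ℕ.+ 1 ⟧ * inv (q ℕ.^ (2 ℕ.* a ℕ.+ 3)) ≡ (1ℚ - t + t ^ 2) * t ^ (2 ℕ.* a ℕ.+ 1)
    ⟦q²-q+1⟧*inv[q^[2a+3]] a = begin
      ⟦ q ℕ.^ 2 ∸ q ℕ.+ 1 ⟧ * inv (q ℕ.^ (2 ℕ.* a ℕ.+ 3))
        ≡⟨ cong₂ _*_ ⟦q²-q+1⟧ (trans (inv-q^ (2 ℕ.* a ℕ.+ 3)) (trans (cong (t ^_) (2a+3≡2+[2a+1] a)) (^-homo-* t 2 (2 ℕ.* a ℕ.+ 1)))) ⟩
      (Q ^ 2 - Q + 1ℚ) * (t ^ 2 * y)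
        ≡⟨ ℚ.*-assoc (Q ^ 2 - Q + 1ℚ) (t ^ 2) y ⟨
      (Q ^ 2 - Q + 1ℚ) * t ^ 2 * y
        ≡⟨ cong (_* y) ([p²-p+1]q²≡1-q+q² {Q} {t} Qt≡1) ⟩
      (1ℚ - t + t ^ 2) * y
        ∎
      where
      open ≡-Reasoning
      y : ℚ
      y = t ^ (2 ℕ.* a ℕ.+ 1)
      2a+3≡2+[2a+1] : ∀ a → 2 ℕ.* a ℕ.+ 3 ≡ 2 ℕ.+ (2 ℕ.* a ℕ.+ 1)
      2a+3≡2+[2a+1] = ℕ-Solver.solve-∀

    Q^e≡Q^[e+2]*κ*[1-t²] : ∀ e X → Q ^ e * X ≡ Q ^ (e ℕ.+ 2) * κ * ((1ℚ - t ^ 2) * X)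
    Q^e≡Q^[e+2]*κ*[1-t²] e X = begin
      Q ^ e * X                                 ≡⟨ cong (_* X) (ℚ.*-identityʳ (Q ^ e)) ⟨
      Q ^ e * 1ℚ * X                            ≡⟨ cong (λ w → Q ^ e * w * X) Q²[1-t²]κ≡1 ⟨
      Q ^ e * (Q ^ 2 * (1ℚ - t ^ 2) * κ) * X    ≡⟨ regroup (Q ^ e) (Q ^ 2) (1ℚ - t ^ 2) κ X ⟩
      Q ^ e * Q ^ 2 * κ * ((1ℚ - t ^ 2) * X)    ≡⟨ cong (λ w → w * κ * ((1ℚ - t ^ 2) * X)) (^-homo-* Q e 2) ⟨
      Q ^ (e ℕ.+ 2) * κ * ((1ℚ - t ^ 2) * X)    ∎
      where
      open ≡-Reasoning
      regroup : ∀ u v w k x → u * (v * w * k) * x ≡ u * v * k * (w * x)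
      regroup = solve-∀ ℚ-ring

    ψ⁻-even≡Q^[e+2]*κ*φ : ∀ a → ψ⁻ 1 (2 ℕ.* a) q * ((⟦ q ℕ.^ (2 ℕ.* a ℕ.+ 2) ⟧ - 1ℚ) * κ)
      ≡ Q ^ ((2 ℕ.* a ℕ.+ 2) C 2 ∸ 1 ℕ.+ 2) * κ * (φ t (2 ℕ.* a) * (1ℚ - t ^ (2 ℕ.* a ℕ.+ 2)))
    ψ⁻-even≡Q^[e+2]*κ*φ a = begin
      ψ⁻ 1 (2 ℕ.* a) q * ((⟦ q ℕ.^ (2 ℕ.* a ℕ.+ 2) ⟧ - 1ℚ) * κ)
        ≡⟨ cong₂ (λ u v → u * (v * κ)) (ψ⁻≡Q^C*φ (2 ℕ.* a)) (⟦q^⟧-1 (2 ℕ.* a ℕ.+ 2)) ⟩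
      Q ^ C′ * Φ * (Q ^ (2 ℕ.* a ℕ.+ 2) * (1ℚ - z) * κ)
        ≡⟨ regroup (Q ^ C′) Φ (Q ^ (2 ℕ.* a ℕ.+ 2)) (1ℚ - z) κ ⟩
      Q ^ C′ * Q ^ (2 ℕ.* a ℕ.+ 2) * κ * (Φ * (1ℚ - z))
        ≡⟨ cong (λ w → w * κ * (Φ * (1ℚ - z))) (^-homo-* Q C′ (2 ℕ.* a ℕ.+ 2)) ⟨
      Q ^ (C′ ℕ.+ (2 ℕ.* a ℕ.+ 2)) * κ * (Φ * (1ℚ - z))
        ≡⟨ cong (λ k → Q ^ k * κ * (Φ * (1ℚ - z))) ([2a+1]C2+[2a+2]≡[2a+2]C2∸1+2 a) ⟩
      Q ^ ((2 ℕ.* a ℕ.+ 2) C 2 ∸ 1 ℕ.+ 2) * κ * (Φ * (1ℚ - z))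
        ∎
      where
      open ≡-Reasoning
      C′ : ℕ
      C′ = suc (2 ℕ.* a) C 2
      Φ z : ℚ
      Φ = φ t (2 ℕ.* a)
      z = t ^ (2 ℕ.* a ℕ.+ 2)
      regroup : ∀ u Φ v w k → u * Φ * (v * w * k) ≡ u * v * k * (Φ * w)
      regroup = solve-∀ ℚ-ring

    open EulerBounds 0≤t 2t≤1

  ψ⁻-lower-bound : ∀ a → 1 ℕ.≤ a →
    ⟦ q ℕ.^ ((a ℕ.+ 1) C 2) ⟧ * (1ℚ - inv q - inv (q ℕ.^ 2) + inv (q ℕ.^ (a ℕ.+ 1))) ≤ ψ⁻ 1 a q
  ψ⁻-lower-bound a 1≤a = begin
    ⟦ q ℕ.^ ((a ℕ.+ 1) C 2) ⟧ * (1ℚ - t - inv (q ℕ.^ 2) + inv (q ℕ.^ (a ℕ.+ 1)))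
      ≡⟨ cong₂ _*_ (trans (⟦q^⟧ ((a ℕ.+ 1) C 2)) (cong (λ k → Q ^ (k C 2)) (ℕ.+-comm a 1)))
                   (cong₂ (λ u v → 1ℚ - t - u + v) (inv-q^ 2) (inv-q^ (a ℕ.+ 1))) ⟩
    Q ^ (suc a C 2) * (1ℚ - t - t ^ 2 + t ^ (a ℕ.+ 1))
      ≤⟨ *-monoˡ-≤ (^-nonNeg (suc a C 2) 0≤Q) (φ-lower-bound a 1≤a) ⟩
    Q ^ (suc a C 2) * φ t a
      ≡⟨ ψ⁻≡Q^C*φ a ⟨
    ψ⁻ 1 a q
      ∎
    where open ℚ.≤-Reasoning

  ψ⁻-even-lower-bound : ∀ a → 1 ℕ.≤ a →
    ⟦ q ℕ.^ (((2 ℕ.* a ℕ.+ 2) C 2) ∸ 1) ⟧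
        * (1ℚ - inv q - inv (q ℕ.^ 3) + ⟦ q ℕ.^ 2 ∸ q ℕ.+ 1 ⟧ * inv (q ℕ.^ (2 ℕ.* a ℕ.+ 3)))
      ≤ ψ⁻ 1 (2 ℕ.* a) q * ((⟦ q ℕ.^ (2 ℕ.* a ℕ.+ 2) ⟧ - 1ℚ) * inv (q ℕ.^ 2 ∸ 1))
  ψ⁻-even-lower-bound a 1≤a = begin
    ⟦ q ℕ.^ e ⟧ * (1ℚ - t - inv (q ℕ.^ 3) + ⟦ q ℕ.^ 2 ∸ q ℕ.+ 1 ⟧ * inv (q ℕ.^ (2 ℕ.* a ℕ.+ 3)))
      ≡⟨ cong₂ _*_ (⟦q^⟧ e) (cong₂ (λ u v → 1ℚ - t - u + v) (inv-q^ 3) (⟦q²-q+1⟧*inv[q^[2a+3]] a)) ⟩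
    Q ^ e * X
      ≡⟨ Q^e≡Q^[e+2]*κ*[1-t²] e X ⟩
    Q ^ (e ℕ.+ 2) * κ * ((1ℚ - t ^ 2) * X)
      ≤⟨ *-monoˡ-≤ (*-nonNeg (^-nonNeg (e ℕ.+ 2) 0≤Q) (inv-nonNeg (q ℕ.^ 2 ∸ 1))) (φ-even-lower-bound a 1≤a) ⟩
    Q ^ (e ℕ.+ 2) * κ * (φ t (2 ℕ.* a) * (1ℚ - t ^ (2 ℕ.* a ℕ.+ 2)))
      ≡⟨ ψ⁻-even≡Q^[e+2]*κ*φ a ⟨
    ψ⁻ 1 (2 ℕ.* a) q * ((⟦ q ℕ.^ (2 ℕ.* a ℕ.+ 2) ⟧ - 1ℚ) * κ)
      ∎
    where
    open ℚ.≤-Reasoning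
    e : ℕ
    e = (2 ℕ.* a ℕ.+ 2) C 2 ∸ 1
    X : ℚ
    X = 1ℚ - t - t ^ 3 + (1ℚ - t + t ^ 2) * t ^ (2 ℕ.* a ℕ.+ 1)

IsPrimePower⇒2≤ : ∀ {q} → IsPrimePower q → 2 ℕ.≤ q
IsPrimePower⇒2≤ (p , k , p-prime , 1≤k , refl) = begin
  2          ≤⟨ ℕ.nonTrivial⇒n>1 p {{prime⇒nonTrivial p-prime}} ⟩
  p          ≡⟨ ℕ.^-identityʳ p ⟨
  p ℕ.^ 1    ≤⟨ ℕ.^-monoʳ-≤ p {{prime⇒nonZero p-prime}} 1≤k ⟩
  p ℕ.^ k    ∎
  where open ℕ.≤-Reasoning

lemma2p10 : (q a : ℕ) → IsPrimePower q → 1 ℕ.≤ a →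
    (⟦ q ℕ.^ ((a ℕ.+ 1) C 2) ⟧ * (1ℚ - inv q - inv (q ℕ.^ 2) + inv (q ℕ.^ (a ℕ.+ 1)))
      ≤ ψ⁻ 1 a q)
    ×
    (⟦ q ℕ.^ (((2 ℕ.* a ℕ.+ 2) C 2) ∸ 1) ⟧
        * (1ℚ - inv q - inv (q ℕ.^ 3)
           + ⟦ q ℕ.^ 2 ∸ q ℕ.+ 1 ⟧ * inv (q ℕ.^ (2 ℕ.* a ℕ.+ 3)))
      ≤ ψ⁻ 1 (2 ℕ.* a) q * ((⟦ q ℕ.^ (2 ℕ.* a ℕ.+ 2) ⟧ - 1ℚ) * inv (q ℕ.^ 2 ∸ 1)))
lemma2p10 q a q-prime-power 1≤a = ψ⁻-lower-bound q 2≤q a 1≤a , ψ⁻-even-lower-bound q 2≤q a 1≤a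
  where
  2≤q : 2 ℕ.≤ q
  2≤q = IsPrimePower⇒2≤ q-prime-power
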